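{- For every $k\ge2$, the rubbling number of the even cycle is $\rho(C_{2k})=2^k$.
   Context: A pebble distribution on a graph $G$ is a function $p:V(G)\to\mathbb{Z}_{\ge0}$, its size is $\sum_v p(v)$. If $\{v,u\}\in E(G)$, the pebbling move $(v,v\to u)$ removes two pebbles at $v$ and adds one at $u$. If $v\ne w$ and $\{v,u\},\{w,u\}\in E(G)$, the strict rubbling move $(v,w\to u)$ removes one pebble at each of $v$ and $w$ and adds one at $u$. A rubbling move is either of these. A vertex $x$ is reachable from $p$ if there is a sequence of rubbling moves, with pebble counts never becoming negative, after which $x$ has at least one pebble. The rubbling number $\rho(G)$ is the minimum $m$ such that every vertex of $G$ is reachable from every pebble distribution of size $m$. -}

module Defs where

open import Data.Nat using (ℕ; zero; suc; _+_; _*_; _∸_; _^_; _≤_; _<_)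
open import Data.Fin using (Fin; toℕ; _≟_)
open import Data.List using (map; allFin)
open import Data.Nat.ListAction using (sum)
open import Data.Product using (_×_; ∃)
open import Data.Sum using (_⊎_)
open import Relation.Nullary using (¬_; yes; no)
open import Relation.Binary.PropositionalEquality using (_≡_)
open import Relation.Binary.Construct.Closure.ReflexiveTransitive using (Star)

record Graph : Set₁ where
  field
    n   : ℕ
    Adj : Fin n → Fin n → Set

open Graph public

-- The cycle C_n on vertices 0,1,…,n-1 (edges {i,i+1} and {n-1,0}); a cycle for n ≥ 3.
Cycle : ℕ → Graph
Cycle m = record
  { n = m
  ; Adj = λ i j → (toℕ j ≡ suc (toℕ i)) ⊎ (toℕ i ≡ suc (toℕ j))
                  ⊎ ((toℕ i ≡ 0 × toℕ j ≡ m ∸ 1) ⊎ (toℕ j ≡ 0 × toℕ i ≡ m ∸ 1)) }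

Distribution : Graph → Set
Distribution G = Fin (n G) → ℕ

size : (G : Graph) → Distribution G → ℕ
size G p = sum (map p (allFin (n G)))

ind : ∀ {m} → Fin m → Fin m → ℕ
ind x v with x ≟ v
... | yes _ = 1
... | no _  = 0

pebbleMove : (G : Graph) → Distribution G → Fin (n G) → Fin (n G) → Distribution G
pebbleMove G p v u x = (p x ∸ (ind x v + ind x v)) + ind x u

strictMove : (G : Graph) → Distribution G → Fin (n G) → Fin (n G) → Fin (n G) → Distribution G
strictMove G p v w u x = ((p x ∸ ind x v) ∸ ind x w) + ind x u

-- One rubbling move from p to q (pebble counts never negative: enough pebbles are required).
data Step (G : Graph) (p : Distribution G) : Distribution G → Set where
  pebbling : (v u : Fin (n G)) → Adj G v u → 2 ≤ p v → Step G p (pebbleMove G p v u)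
  strict   : (v w u : Fin (n G)) → ¬ (v ≡ w) → Adj G v u → Adj G w u →
             1 ≤ p v → 1 ≤ p w → Step G p (strictMove G p v w u)

Reachable : (G : Graph) → Distribution G → Fin (n G) → Set
Reachable G p x = ∃ λ q → Star (Step G) p q × 1 ≤ q x

Solvable : Graph → ℕ → Set
Solvable G m = (p : Distribution G) → size G p ≡ m → (x : Fin (n G)) → Reachable G p x

IsRubblingNumber : Graph → ℕ → Set
IsRubblingNumber G m = Solvable G m × ((m' : ℕ) → m' < m → ¬ Solvable G m')

module Submission where

-- Lower bound: give each vertex y of C_2k the weight 2^(k ∸ d(y, k)). Weights at most double along an
-- edge, so no rubbling move increases the total weight of the pebbles; 2^k − 1 pebbles on vertex 0
-- (weight 1 each) therefore never reach vertex k (weight 2^k).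
-- Upper bound: for a target x, weight the pebbles on each of the two arcs from x to its antipode by
-- 2^(k − distance to x). Every vertex except the antipode gets weight at least 2 on one arc, so the two
-- arc weights add up to at least twice the number 2^k of pebbles, and one arc carries weight 2^k.
-- Pebbling moves along that arc, one vertex at a time, then put a pebble on x.

open import Defs
open import Data.Nat using (ℕ; zero; suc; _+_; _*_; _∸_; _^_; _≤_; _<_; z≤n; s≤s; _≤?_; _<?_; ∣_-_∣)
open import Data.Nat.Properties hiding (_≟_)
open import Data.Nat.DivMod
open import Data.Fin using (Fin; toℕ; _≟_; fromℕ<) renaming (zero to fz; suc to fs)
open import Data.Fin.Properties using (toℕ-injective; toℕ<n; toℕ-fromℕ<) renaming (suc-injective to fs-injective)
open import Data.Product using (_×_; _,_; ∃)
open import Data.Sum using (_⊎_; inj₁; inj₂)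
open import Data.Empty using (⊥-elim)
open import Relation.Nullary using (¬_; yes; no; Dec)
open import Relation.Binary.PropositionalEquality
open import Function using (_∘_)
open import Data.List using (tabulate)
import Data.Nat.ListAction as List
open import Algebra.Properties.CommutativeMonoid.Sum +-0-commutativeMonoid
  using (sum-syntax; ∑-distrib-+; sum-cong-≗; sum-replicate-zero)
open import Data.Nat.Tactic.RingSolver using (solve-∀)
open import Relation.Binary.Construct.Closure.ReflexiveTransitive using (Star; ε; _◅_; _◅◅_)

ind-refl : ∀ {m} (x : Fin m) → ind x x ≡ 1
ind-refl x with x ≟ x
... | yes _ = refl
... | no x≢x = ⊥-elim (x≢x refl)

ind-≢ : ∀ {m} {x v : Fin m} → x ≢ v → ind x v ≡ 0
ind-≢ {x = x} {v} x≢v with x ≟ v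
... | yes x≡v = ⊥-elim (x≢v x≡v)
... | no _ = refl

ind-suc : ∀ {m} (y v : Fin m) → ind (fs y) (fs v) ≡ ind y v
ind-suc y v = by-cases (y ≟ v)
  where
    by-cases : Dec (y ≡ v) → ind (fs y) (fs v) ≡ ind y v
    by-cases (yes refl) = trans (ind-refl (fs y)) (sym (ind-refl y))
    by-cases (no y≢v) = trans (ind-≢ (y≢v ∘ fs-injective)) (sym (ind-≢ y≢v))

2*ind≤ : ∀ {m} (p : Fin m → ℕ) {v} → 2 ≤ p v → ∀ y → ind y v + ind y v ≤ p y
2*ind≤ p {v} 2≤pv y with y ≟ v
... | yes refl = 2≤pv
... | no _ = z≤n

ind+ind≤ : ∀ {m} (p : Fin m → ℕ) {v w} → v ≢ w → 1 ≤ p v → 1 ≤ p w → ∀ y → ind y v + ind y w ≤ p y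
ind+ind≤ p {v} {w} v≢w 1≤pv 1≤pw y with y ≟ v | y ≟ w
... | yes refl | yes refl = ⊥-elim (v≢w refl)
... | yes refl | no _ = 1≤pv
... | no _ | yes refl = 1≤pw
... | no _ | no _ = z≤n

size≡∑ : ∀ G (p : Distribution G) → size G p ≡ ∑[ y < n G ] p y
size≡∑ G p = go (n G) (λ y → y)
  where
    go : ∀ m (h : Fin m → Fin (n G)) → List.sum (Data.List.map p (tabulate h)) ≡ ∑[ y < m ] p (h y)
    go zero h = refl
    go (suc m) h = cong (p (h fz) +_) (go m (h ∘ fs))

∑-ind : ∀ {m} (v : Fin m) (g : Fin m → ℕ) → ∑[ y < m ] (ind y v * g y) ≡ g v
∑-ind {suc m} fz g = begin
  ind {suc m} fz fz * g fz + ∑[ y < m ] (ind (fs y) fz * g (fs y))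
    ≡⟨ cong₂ _+_ (cong (_* g fz) (ind-refl {suc m} fz)) (sum-cong-≗ λ y → cong (_* g (fs y)) (ind-≢ {x = fs y} {fz} λ ())) ⟩
  1 * g fz + ∑[ y < m ] 0
    ≡⟨ cong₂ _+_ (*-identityˡ (g fz)) (sum-replicate-zero m) ⟩
  g fz + 0
    ≡⟨ +-identityʳ (g fz) ⟩
  g fz ∎
  where open ≡-Reasoning
∑-ind {suc m} (fs v) g = begin
  ind fz (fs v) * g fz + ∑[ y < m ] (ind (fs y) (fs v) * g (fs y))
    ≡⟨ cong₂ _+_ (cong (_* g fz) (ind-≢ {x = fz} {fs v} λ ())) (sum-cong-≗ λ y → cong (_* g (fs y)) (ind-suc y v)) ⟩
  ∑[ y < m ] (ind y v * g (fs y))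
    ≡⟨ ∑-ind v (g ∘ fs) ⟩
  g (fs v) ∎
  where open ≡-Reasoning

term≤∑ : ∀ {m} (g : Fin m → ℕ) v → g v ≤ ∑[ y < m ] g y
term≤∑ g fz = m≤m+n (g fz) _
term≤∑ g (fs v) = ≤-trans (term≤∑ (g ∘ fs) v) (m≤n+m _ (g fz))

-- A move replaces a by (a ∸ r) + j at every vertex, with r ≤ a.
move-mono : ∀ {a a' d r} j → r ≤ a → a + d ≤ a' → (a ∸ r) + j + d ≤ (a' ∸ r) + j
move-mono {a} {a'} {d} {r} j r≤a a+d≤a' = begin
  (a ∸ r) + j + d   ≡⟨ +-assoc (a ∸ r) j d ⟩
  (a ∸ r) + (j + d) ≡⟨ cong ((a ∸ r) +_) (+-comm j d) ⟩
  (a ∸ r) + (d + j) ≡⟨ +-assoc (a ∸ r) d j ⟨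
  (a ∸ r) + d + j   ≡⟨ cong (_+ j) (+-∸-comm d r≤a) ⟨
  (a + d ∸ r) + j   ≤⟨ +-monoˡ-≤ j (∸-monoˡ-≤ r a+d≤a') ⟩
  (a' ∸ r) + j      ∎
  where open ≤-Reasoning

module _ {G : Graph} where

  _⊒_+_ : Distribution G → Distribution G → Distribution G → Set
  q ⊒ p + d = ∀ y → p y + d y ≤ q y

  Step-mono : ∀ {p q p'} d → Step G p q → p' ⊒ p + d → ∃ λ q' → Step G p' q' × q' ⊒ q + d
  Step-mono {p} {p' = p'} d (pebbling v u v~u 2≤pv) p'⊒ =
    pebbleMove G p' v u ,
    pebbling v u v~u (≤-trans 2≤pv (m+n≤o⇒m≤o (p v) (p'⊒ v))) ,
    λ y → move-mono (ind y u) (2*ind≤ p 2≤pv y) (p'⊒ y)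
  Step-mono {p} {p' = p'} d (strict v w u v≢w v~u w~u 1≤pv 1≤pw) p'⊒ =
    strictMove G p' v w u ,
    strict v w u v≢w v~u w~u (≤-trans 1≤pv (m+n≤o⇒m≤o (p v) (p'⊒ v)))
                             (≤-trans 1≤pw (m+n≤o⇒m≤o (p w) (p'⊒ w))) ,
    λ y → subst₂ (λ a a' → a + ind y u + d y ≤ a' + ind y u)
            (sym (∸-+-assoc (p y) (ind y v) (ind y w))) (sym (∸-+-assoc (p' y) (ind y v) (ind y w)))
            (move-mono (ind y u) (ind+ind≤ p v≢w 1≤pv 1≤pw y) (p'⊒ y))

  Star-mono : ∀ {p q p'} d → Star (Step G) p q → p' ⊒ p + d → ∃ λ q' → Star (Step G) p' q' × q' ⊒ q + d
  Star-mono d ε p'⊒ = _ , ε , p'⊒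
  Star-mono d (s ◅ ss) p'⊒ with Step-mono d s p'⊒
  ... | _ , s' , q₁⊒ with Star-mono d ss q₁⊒
  ... | q' , ss' , q'⊒ = q' , s' ◅ ss' , q'⊒

  pebbling-repeat : ∀ t {p v u} → Adj G v u → v ≢ u → 2 * t ≤ p v → ∃ λ q → Star (Step G) p q × p u + t ≤ q u
  pebbling-repeat zero _ _ _ = _ , ε , ≤-reflexive (+-identityʳ _)
  pebbling-repeat (suc t) {p} {v} {u} v~u v≢u 2[1+t]≤pv =
    let q , ss , p'u+t≤qu = pebbling-repeat t v~u v≢u 2t≤p'v
    in q , pebbling v u v~u (m+n≤o⇒n≤o (2 * t) 2t+2≤pv) ◅ ss , subst (_≤ q u) p'u+t≡pu+1+t p'u+t≤qu
    where
      p' = pebbleMove G p v u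
      2t+2≤pv : 2 * t + 2 ≤ p v
      2t+2≤pv = subst (_≤ p v) (trans (*-suc 2 t) (+-comm 2 (2 * t))) 2[1+t]≤pv
      2t≤p'v : 2 * t ≤ p' v
      2t≤p'v rewrite ind-refl v | ind-≢ v≢u | +-identityʳ (p v ∸ 2) = m+n≤o⇒m≤o∸n (2 * t) 2t+2≤pv
      p'u+t≡pu+1+t : p' u + t ≡ p u + suc t
      p'u+t≡pu+1+t rewrite ind-refl u | ind-≢ (v≢u ∘ sym) = +-assoc (p u) 1 t

-- Weight potential

a+x≡b+y⇒a≤b : ∀ {a b x y} → a + x ≡ b + y → y ≤ x → a ≤ b
a+x≡b+y⇒a≤b {a} {b} {x} a+x≡b+y y≤x = +-cancelʳ-≤ x a b (≤-trans (≤-reflexive a+x≡b+y) (+-monoʳ-≤ b y≤x))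

module Potential (G : Graph) (wt : Fin (n G) → ℕ) (wt-Adj : ∀ {v u} → Adj G v u → wt u ≤ 2 * wt v) where

  potential : Distribution G → ℕ
  potential p = ∑[ y < n G ] (p y * wt y)

  ∑-ind+ind : ∀ v w → ∑[ y < n G ] ((ind y v + ind y w) * wt y) ≡ wt v + wt w
  ∑-ind+ind v w = begin
    ∑[ y < n G ] ((ind y v + ind y w) * wt y)           ≡⟨ sum-cong-≗ (λ y → *-distribʳ-+ (wt y) (ind y v) (ind y w)) ⟩
    ∑[ y < n G ] (ind y v * wt y + ind y w * wt y)      ≡⟨ ∑-distrib-+ (λ y → ind y v * wt y) (λ y → ind y w * wt y) ⟩
    ∑[ y < n G ] (ind y v * wt y) + ∑[ y < n G ] (ind y w * wt y) ≡⟨ cong₂ _+_ (∑-ind v wt) (∑-ind w wt) ⟩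
    wt v + wt w                                         ∎
    where open ≡-Reasoning

  potential-move : ∀ p (r : Distribution G) u → (∀ y → r y ≤ p y) →
    potential (λ y → (p y ∸ r y) + ind y u) + ∑[ y < n G ] (r y * wt y) ≡ potential p + wt u
  potential-move p r u r≤p = begin
    potential (λ y → (p y ∸ r y) + ind y u) + ∑[ y < n G ] (r y * wt y)
      ≡⟨ ∑-distrib-+ (λ y → ((p y ∸ r y) + ind y u) * wt y) (λ y → r y * wt y) ⟨
    ∑[ y < n G ] (((p y ∸ r y) + ind y u) * wt y + r y * wt y)
      ≡⟨ sum-cong-≗ (λ y → regroup (p y) (r y) (ind y u) (wt y) (r≤p y)) ⟩
    ∑[ y < n G ] (p y * wt y + ind y u * wt y)
      ≡⟨ ∑-distrib-+ (λ y → p y * wt y) (λ y → ind y u * wt y) ⟩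
    potential p + ∑[ y < n G ] (ind y u * wt y)
      ≡⟨ cong (potential p +_) (∑-ind u wt) ⟩
    potential p + wt u ∎
    where
      open ≡-Reasoning
      regroup : ∀ a e j w → e ≤ a → ((a ∸ e) + j) * w + e * w ≡ a * w + j * w
      regroup a e j w e≤a = trans (swap (a ∸ e) e j w) (cong (λ x → x * w + j * w) (m∸n+n≡m e≤a))
        where swap : ∀ x e j w → (x + j) * w + e * w ≡ (x + e) * w + j * w
              swap = solve-∀

  potential-Step : ∀ {p q} → Step G p q → potential q ≤ potential p
  potential-Step {p} (pebbling v u v~u 2≤pv) =
    a+x≡b+y⇒a≤b (trans (cong (potential (pebbleMove G p v u) +_) (sym (∑-ind+ind v v)))
                        (potential-move p (λ y → ind y v + ind y v) u (2*ind≤ p 2≤pv)))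
                 (≤-trans (wt-Adj v~u) (≤-reflexive (cong (wt v +_) (+-identityʳ (wt v)))))
  potential-Step {p} (strict v w u v≢w v~u w~u 1≤pv 1≤pw) =
    a+x≡b+y⇒a≤b (trans (cong₂ _+_ (sum-cong-≗ λ y → cong (λ a → (a + ind y u) * wt y) (∸-+-assoc (p y) (ind y v) (ind y w)))
                                  (sym (∑-ind+ind v w)))
                        (potential-move p (λ y → ind y v + ind y w) u (ind+ind≤ p v≢w 1≤pv 1≤pw)))
                 wu≤wv+ww
    where
      open ≤-Reasoning
      wu≤wv+ww : wt u ≤ wt v + wt w
      wu≤wv+ww = *-cancelˡ-≤ 2 (begin
        2 * wt u                ≡⟨ cong (wt u +_) (+-identityʳ (wt u)) ⟩
        wt u + wt u             ≤⟨ +-mono-≤ (wt-Adj v~u) (wt-Adj w~u) ⟩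
        2 * wt v + 2 * wt w     ≡⟨ *-distribˡ-+ 2 (wt v) (wt w) ⟨
        2 * (wt v + wt w)       ∎)

  potential-Star : ∀ {p q} → Star (Step G) p q → potential q ≤ potential p
  potential-Star ε = ≤-refl
  potential-Star (s ◅ ss) = ≤-trans (potential-Star ss) (potential-Step s)

  reachable⇒wt≤potential : ∀ {p x} → Reachable G p x → wt x ≤ potential p
  reachable⇒wt≤potential {p} {x} (q , run , 1≤qx) = begin
    wt x                       ≡⟨ *-identityˡ (wt x) ⟨
    1 * wt x                   ≤⟨ *-monoˡ-≤ (wt x) 1≤qx ⟩
    q x * wt x                 ≤⟨ term≤∑ (λ y → q y * wt y) x ⟩
    potential q                ≤⟨ potential-Star run ⟩
    potential p                ∎
    where open ≤-Reasoning

-- Pebbling along a path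

pathWeight : (ℕ → ℕ) → ℕ → ℕ
pathWeight g zero = g 0
pathWeight g (suc L) = g 0 * 2 ^ suc L + pathWeight (g ∘ suc) L

pathWeight-cong : ∀ L {g g'} → (∀ i → i ≤ L → g i ≡ g' i) → pathWeight g L ≡ pathWeight g' L
pathWeight-cong zero g≗g' = g≗g' 0 z≤n
pathWeight-cong (suc L) g≗g' =
  cong₂ _+_ (cong (_* 2 ^ suc L) (g≗g' 0 z≤n)) (pathWeight-cong L (λ i i≤L → g≗g' (suc i) (s≤s i≤L)))

deficit-bound : ∀ L {t a w} → 2 ^ suc L * t ≤ a * 2 ^ suc L + w → 2 ^ L * (2 * (t ∸ a)) ≤ w
deficit-bound L {t} {a} {w} 2^[1+L]t≤ = begin
  2 ^ L * (2 * (t ∸ a))           ≡⟨ *-assoc (2 ^ L) 2 (t ∸ a) ⟨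
  2 ^ L * 2 * (t ∸ a)             ≡⟨ cong (_* (t ∸ a)) (*-comm (2 ^ L) 2) ⟩
  2 ^ suc L * (t ∸ a)             ≡⟨ *-distribˡ-∸ (2 ^ suc L) t a ⟩
  2 ^ suc L * t ∸ 2 ^ suc L * a   ≤⟨ m≤n+o⇒m∸n≤o _ _ (subst (λ x → 2 ^ suc L * t ≤ x + w) (*-comm a (2 ^ suc L)) 2^[1+L]t≤) ⟩
  w                               ∎
  where open ≤-Reasoning

clear : ∀ {m} → Fin m → (Fin m → ℕ) → Fin m → ℕ
clear v p y with y ≟ v
... | yes _ = 0
... | no _ = p y

clear-self : ∀ {m} v (p : Fin m → ℕ) → clear v p v ≡ 0
clear-self v p with v ≟ v
... | yes _ = refl
... | no v≢v = ⊥-elim (v≢v refl)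

clear-≢ : ∀ {m} {v y} (p : Fin m → ℕ) → y ≢ v → clear v p y ≡ p y
clear-≢ {v = v} {y} p y≢v with y ≟ v
... | yes y≡v = ⊥-elim (y≢v y≡v)
... | no _ = refl

clear-≤ : ∀ {m} v (p : Fin m → ℕ) y → clear v p y ≤ p y
clear-≤ v p y with y ≟ v
... | yes _ = z≤n
... | no _ = ≤-refl

record SimplePath (G : Graph) (L : ℕ) (π : ℕ → Fin (n G)) : Set where
  field
    adjacent  : ∀ i → i < L → Adj G (π (suc i)) (π i)
    injective : ∀ {i j} → i ≤ L → j ≤ L → π i ≡ π j → i ≡ j

open SimplePath

SimplePath-tail : ∀ {G L π} → SimplePath G (suc L) π → SimplePath G L (π ∘ suc)
SimplePath-tail P .adjacent i i<L = P .adjacent (suc i) (s≤s i<L)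
SimplePath-tail P .injective i≤L j≤L e = suc-injective (P .injective (s≤s i≤L) (s≤s j≤L) e)

SimplePath-≢head : ∀ {G L π} → SimplePath G L π → ∀ {i} → suc i ≤ L → π (suc i) ≢ π 0
SimplePath-≢head P 1+i≤L e with P .injective 1+i≤L z≤n e
... | ()

module _ {G : Graph} where

  -- The deficit t ∸ p (π 0) is doubled and requested at π 1 from p with π 0 cleared, so that the
  -- pebbles already on π 0 stay put; the doubled deficit is then moved across the first edge.
  path-reach : ∀ L {π} → SimplePath G L π → ∀ p t → 2 ^ L * t ≤ pathWeight (p ∘ π) L →
               ∃ λ q → Star (Step G) p q × t ≤ q (π 0)
  path-reach zero _ p t 1*t≤pπ₀ = p , ε , subst (_≤ p _) (*-identityˡ t) 1*t≤pπ₀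
  path-reach (suc L) {π} P p t bound with t ≤? p (π 0)
  ... | yes t≤pπ₀ = p , ε , t≤pπ₀
  ... | no t≰pπ₀ =
    let q₁ , run₁ , 2d≤q₁π₁ = path-reach L (SimplePath-tail P) p' (2 * deficit) tail-bound
        q₂ , run₂ , q₂⊒ = Star-mono (λ y → p y ∸ p' y) run₁ (λ y → ≤-reflexive (m+[n∸m]≡n (clear-≤ (π 0) p y)))
        q₃ , run₃ , q₂π₀+d≤q₃π₀ = pebbling-repeat deficit (P .adjacent 0 (s≤s z≤n)) (SimplePath-≢head P (s≤s z≤n))
                                    (≤-trans 2d≤q₁π₁ (m+n≤o⇒m≤o _ (q₂⊒ (π 1))))
    in q₃ , run₂ ◅◅ run₃ , ≤-trans (t≤pπ₀+d q₂ (m+n≤o⇒n≤o _ (q₂⊒ (π 0)))) q₂π₀+d≤q₃π₀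
    where
      p' = clear (π 0) p
      deficit = t ∸ p (π 0)
      tail-bound : 2 ^ L * (2 * deficit) ≤ pathWeight (p' ∘ π ∘ suc) L
      tail-bound = subst (2 ^ L * (2 * deficit) ≤_)
        (pathWeight-cong L (λ i i≤L → sym (clear-≢ p (SimplePath-≢head P (s≤s i≤L)))))
        (deficit-bound L {a = p (π 0)} bound)
      t≤pπ₀+d : ∀ q → p (π 0) ∸ p' (π 0) ≤ q (π 0) → t ≤ q (π 0) + deficit
      t≤pπ₀+d q pπ₀≤qπ₀ rewrite clear-self (π 0) p =
        ≤-trans (≤-reflexive (sym (m+[n∸m]≡n (≰⇒≥ t≰pπ₀)))) (+-monoˡ-≤ deficit pπ₀≤qπ₀)

  reach-along : ∀ L {π p x} → SimplePath G L π → π 0 ≡ x → 2 ^ L ≤ pathWeight (p ∘ π) L → Reachable G p x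
  reach-along L {π} {p} P refl heavy = path-reach L P _ 1 (subst (_≤ pathWeight (p ∘ π) L) (sym (*-identityʳ (2 ^ L))) heavy)

sumUpTo : ℕ → (ℕ → ℕ) → ℕ
sumUpTo zero h = 0
sumUpTo (suc n) h = h 0 + sumUpTo n (h ∘ suc)

sumUpTo-cong : ∀ n {h h'} → (∀ i → i < n → h i ≡ h' i) → sumUpTo n h ≡ sumUpTo n h'
sumUpTo-cong zero _ = refl
sumUpTo-cong (suc n) h≗h' = cong₂ _+_ (h≗h' 0 (s≤s z≤n)) (sumUpTo-cong n (λ i i<n → h≗h' (suc i) (s≤s i<n)))

sumUpTo-+ : ∀ a b h → sumUpTo (a + b) h ≡ sumUpTo a h + sumUpTo b (λ i → h (a + i))
sumUpTo-+ zero b h = refl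
sumUpTo-+ (suc a) b h = trans (cong (h 0 +_) (sumUpTo-+ a b (h ∘ suc))) (sym (+-assoc (h 0) _ _))

sumUpTo-suc : ∀ n h → sumUpTo (suc n) h ≡ sumUpTo n h + h n
sumUpTo-suc zero h = +-comm (h 0) 0
sumUpTo-suc (suc n) h = trans (cong (h 0 +_) (sumUpTo-suc n (h ∘ suc))) (sym (+-assoc (h 0) _ _))

sumUpTo-reverse : ∀ n h → sumUpTo n h ≡ sumUpTo n (λ i → h (n ∸ suc i))
sumUpTo-reverse zero h = refl
sumUpTo-reverse (suc n) h = trans (sumUpTo-suc n h) (trans (+-comm _ (h n)) (cong (h n +_) (sumUpTo-reverse n h)))

sumUpTo-shift : ∀ n h → h n ≡ h 0 → sumUpTo n (h ∘ suc) ≡ sumUpTo n h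
sumUpTo-shift n h hn≡h0 = +-cancelˡ-≡ (h 0) _ _ (begin
  h 0 + sumUpTo n (h ∘ suc) ≡⟨ sumUpTo-suc n h ⟩
  sumUpTo n h + h n         ≡⟨ cong (sumUpTo n h +_) hn≡h0 ⟩
  sumUpTo n h + h 0         ≡⟨ +-comm (sumUpTo n h) (h 0) ⟩
  h 0 + sumUpTo n h         ∎)
  where open ≡-Reasoning

sumUpTo-rotate : ∀ n h → (∀ i → h (i + n) ≡ h i) → ∀ s → sumUpTo n (λ i → h (s + i)) ≡ sumUpTo n h
sumUpTo-rotate n h periodic zero = refl
sumUpTo-rotate n h periodic (suc s) = begin
  sumUpTo n (λ i → h (suc s + i)) ≡⟨ sumUpTo-cong n (λ i _ → cong h (sym (+-suc s i))) ⟩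
  sumUpTo n (λ i → h (s + suc i)) ≡⟨ sumUpTo-shift n (λ i → h (s + i)) (trans (periodic s) (cong h (sym (+-identityʳ s)))) ⟩
  sumUpTo n (λ i → h (s + i))     ≡⟨ sumUpTo-rotate n h periodic s ⟩
  sumUpTo n h                     ∎
  where open ≡-Reasoning

∑≡sumUpTo : ∀ {n} (g : Fin n → ℕ) h → (∀ y → g y ≡ h (toℕ y)) → ∑[ y < n ] g y ≡ sumUpTo n h
∑≡sumUpTo {zero} g h _ = refl
∑≡sumUpTo {suc n} g h g≗h = cong₂ _+_ (g≗h fz) (∑≡sumUpTo (g ∘ fs) (h ∘ suc) (g≗h ∘ fs))

2*sum+last≤pathWeight : ∀ L g → 2 * sumUpTo L g + g L ≤ pathWeight g L
2*sum+last≤pathWeight zero g = ≤-refl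
2*sum+last≤pathWeight (suc L) g = begin
  2 * (g 0 + sumUpTo L (g ∘ suc)) + g (suc L)     ≡⟨ cong (_+ g (suc L)) (*-distribˡ-+ 2 (g 0) _) ⟩
  2 * g 0 + 2 * sumUpTo L (g ∘ suc) + g (suc L)   ≡⟨ +-assoc (2 * g 0) _ _ ⟩
  2 * g 0 + (2 * sumUpTo L (g ∘ suc) + g (suc L)) ≤⟨ +-mono-≤ 2*g0≤ (2*sum+last≤pathWeight L (g ∘ suc)) ⟩
  g 0 * 2 ^ suc L + pathWeight (g ∘ suc) L        ∎
  where
    open ≤-Reasoning
    2*g0≤ : 2 * g 0 ≤ g 0 * 2 ^ suc L
    2*g0≤ = subst (_≤ g 0 * 2 ^ suc L) (*-comm (g 0) 2) (*-monoʳ-≤ (g 0) (*-monoʳ-≤ 2 (m^n>0 2 L)))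

2*sum∘suc≤pathWeight+last : ∀ L g → 2 * sumUpTo L (g ∘ suc) ≤ pathWeight g L + g L
2*sum∘suc≤pathWeight+last L g = begin
  2 * sumUpTo L (g ∘ suc)             ≤⟨ *-monoʳ-≤ 2 (m≤n+m _ (g 0)) ⟩
  2 * sumUpTo (suc L) g               ≡⟨ cong (2 *_) (sumUpTo-suc L g) ⟩
  2 * (sumUpTo L g + g L)             ≡⟨ *-distribˡ-+ 2 (sumUpTo L g) (g L) ⟩
  2 * sumUpTo L g + (g L + (g L + 0)) ≡⟨ cong (2 * sumUpTo L g +_) (cong (g L +_) (+-identityʳ (g L))) ⟩
  2 * sumUpTo L g + (g L + g L)       ≡⟨ +-assoc (2 * sumUpTo L g) (g L) (g L) ⟨
  2 * sumUpTo L g + g L + g L         ≤⟨ +-monoˡ-≤ (g L) (2*sum+last≤pathWeight L g) ⟩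
  pathWeight g L + g L                ∎
  where open ≤-Reasoning

2*n≤a+b⇒n≤b : ∀ {n a b} → 2 * n ≤ a + b → a ≤ n → n ≤ b
2*n≤a+b⇒n≤b {n} {a} {b} 2n≤a+b a≤n = +-cancelˡ-≤ n n b (begin
  n + n ≡⟨ cong (n +_) (+-identityʳ n) ⟨
  2 * n ≤⟨ 2n≤a+b ⟩
  a + b ≤⟨ +-monoˡ-≤ b a≤n ⟩
  n + b ∎)
  where open ≤-Reasoning

∣1+n-n∣≡1 : ∀ n → ∣ suc n - n ∣ ≡ 1
∣1+n-n∣≡1 zero = refl
∣1+n-n∣≡1 (suc n) = ∣1+n-n∣≡1 n

k∸b≤1+k∸a : ∀ k {a b} → a ≤ suc b → k ∸ b ≤ suc (k ∸ a)
k∸b≤1+k∸a k {zero} {b} _ = ≤-trans (m∸n≤m k b) (n≤1+n k)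
k∸b≤1+k∸a zero {suc a} {b} _ = ≤-trans (≤-reflexive (0∸n≡0 b)) z≤n
k∸b≤1+k∸a (suc k) {suc a} {zero} (s≤s z≤n) = ≤-refl
k∸b≤1+k∸a (suc k) {suc a} {suc b} (s≤s a≤b) = k∸b≤1+k∸a k a≤b

-- The even cycle

module EvenCycle (k₀ : ℕ) where

  k = 2 + k₀
  m = 2 * k
  G = Cycle m

  k<m : k < m
  k<m = m<m+n k {k + 0} (s≤s z≤n)

  Adj-sym : ∀ {a b} → Adj G a b → Adj G b a
  Adj-sym (inj₁ e) = inj₂ (inj₁ e)
  Adj-sym (inj₂ (inj₁ e)) = inj₁ e
  Adj-sym (inj₂ (inj₂ (inj₁ e))) = inj₂ (inj₂ (inj₂ e))
  Adj-sym (inj₂ (inj₂ (inj₂ e))) = inj₂ (inj₂ (inj₁ e))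

  suc-% : ∀ j → suc j % m ≡ suc (j % m) % m
  suc-% j = %-distribˡ-+ 1 j m

  suc-%-cases : ∀ j → (suc j % m ≡ suc (j % m)) ⊎ (suc j % m ≡ 0 × j % m ≡ m ∸ 1)
  suc-%-cases j with suc (j % m) <? m
  ... | yes 1+j%m<m = inj₁ (trans (suc-% j) (m<n⇒m%n≡m 1+j%m<m))
  ... | no 1+j%m≮m = inj₂ (trans (suc-% j) (trans (cong (_% m) 1+j%m≡m) (n%n≡0 m)) , cong (_∸ 1) 1+j%m≡m)
    where 1+j%m≡m : suc (j % m) ≡ m
          1+j%m≡m = ≤-antisym (m%n<n j m) (≮⇒≥ 1+j%m≮m)

  vertex : ℕ → Fin m
  vertex i = i mod m

  toℕ-vertex : ∀ i → toℕ (vertex i) ≡ i % m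
  toℕ-vertex i = toℕ-fromℕ< (m%n<n i m)

  vertex-suc-Adj : ∀ j → Adj G (vertex (suc j)) (vertex j)
  vertex-suc-Adj j with suc-%-cases j
  ... | inj₁ e = inj₂ (inj₁ (trans (toℕ-vertex (suc j)) (trans e (cong suc (sym (toℕ-vertex j))))))
  ... | inj₂ (e₁ , e₂) = inj₂ (inj₂ (inj₁ (trans (toℕ-vertex (suc j)) e₁ , trans (toℕ-vertex j) e₂)))

  vertex-toℕ : ∀ y → vertex (toℕ y) ≡ y
  vertex-toℕ y = toℕ-injective (trans (toℕ-vertex (toℕ y)) (m<n⇒m%n≡m (toℕ<n y)))

  vertex-+m : ∀ i → vertex (i + m) ≡ vertex i
  vertex-+m i = toℕ-injective (trans (toℕ-vertex (i + m)) (trans ([m+n]%n≡m%n i m) (sym (toℕ-vertex i))))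

  _⊕_ : Fin m → ℕ → Fin m
  x ⊕ o = vertex (toℕ x + o)

  ⊕-suc-Adj : ∀ x o → Adj G (x ⊕ suc o) (x ⊕ o)
  ⊕-suc-Adj x o = subst (λ i → Adj G (vertex i) (x ⊕ o)) (sym (+-suc (toℕ x) o)) (vertex-suc-Adj (toℕ x + o))

  ⊕-0 : ∀ x → x ⊕ 0 ≡ x
  ⊕-0 x = trans (cong vertex (+-identityʳ (toℕ x))) (vertex-toℕ x)

  ⊕-m : ∀ x → x ⊕ m ≡ x
  ⊕-m x = trans (vertex-+m (toℕ x)) (vertex-toℕ x)

  offset : Fin m → Fin m → ℕ
  offset x y = (toℕ y + (m ∸ toℕ x)) % m

  offset-⊕ : ∀ x o → offset x (x ⊕ o) ≡ o % m
  offset-⊕ x o = begin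
    (toℕ (x ⊕ o) + (m ∸ s)) % m    ≡⟨ cong (λ z → (z + (m ∸ s)) % m) (toℕ-vertex (s + o)) ⟩
    ((s + o) % m + (m ∸ s)) % m    ≡⟨ %-distribˡ-+ ((s + o) % m) (m ∸ s) m ⟩
    ((s + o) % m % m + (m ∸ s) % m) % m ≡⟨ cong (λ z → (z + (m ∸ s) % m) % m) (m%n%n≡m%n (s + o) m) ⟩
    ((s + o) % m + (m ∸ s) % m) % m ≡⟨ %-distribˡ-+ (s + o) (m ∸ s) m ⟨
    (s + o + (m ∸ s)) % m          ≡⟨ cong (_% m) s+o+[m∸s]≡o+m ⟩
    (o + m) % m                    ≡⟨ [m+n]%n≡m%n o m ⟩
    o % m                          ∎
    where
      open ≡-Reasoning
      s = toℕ x
      s+o+[m∸s]≡o+m : s + o + (m ∸ s) ≡ o + m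
      s+o+[m∸s]≡o+m = begin
        s + o + (m ∸ s)   ≡⟨ cong (_+ (m ∸ s)) (+-comm s o) ⟩
        o + s + (m ∸ s)   ≡⟨ +-assoc o s (m ∸ s) ⟩
        o + (s + (m ∸ s)) ≡⟨ cong (o +_) (m+[n∸m]≡n (<⇒≤ (toℕ<n x))) ⟩
        o + m             ∎

  offset-⊕-< : ∀ x {o} → o < m → offset x (x ⊕ o) ≡ o
  offset-⊕-< x o<m = trans (offset-⊕ x _) (m<n⇒m%n≡m o<m)

  ⊕-injective : ∀ x {o o'} → o < m → o' < m → x ⊕ o ≡ x ⊕ o' → o ≡ o'
  ⊕-injective x o<m o'<m e = trans (sym (offset-⊕-< x o<m)) (trans (cong (offset x) e) (offset-⊕-< x o'<m))

  k≤m∸i : ∀ {i} → i ≤ k → k ≤ m ∸ i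
  k≤m∸i {i} i≤k = m+n≤o⇒m≤o∸n k (subst (k + i ≤_) (cong (k +_) (sym (+-identityʳ k))) (+-monoʳ-≤ k i≤k))

  m∸[1+i]<m : ∀ i → m ∸ suc i < m
  m∸[1+i]<m i = m<n+o⇒m∸n<o m (suc i) (m<n+m m (s≤s z≤n))

  arcA arcB : Fin m → ℕ → Fin m
  arcA x i = x ⊕ i
  arcB x i = x ⊕ (m ∸ i)

  arcA-path : ∀ x → SimplePath G k (arcA x)
  arcA-path x .adjacent i _ = ⊕-suc-Adj x i
  arcA-path x .injective i≤k j≤k = ⊕-injective x (≤-<-trans i≤k k<m) (≤-<-trans j≤k k<m)

  arcB-path : ∀ x → SimplePath G k (arcB x)
  arcB-path x .adjacent i i<k =
    subst (λ o → Adj G (arcB x (suc i)) (x ⊕ o)) (sym (+-∸-assoc 1 (<-trans i<k k<m))) (Adj-sym (⊕-suc-Adj x (m ∸ suc i)))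
  arcB-path x .injective {zero} {zero} _ _ _ = refl
  arcB-path x .injective {zero} {suc j} _ 1+j≤k e with k≤0
    where
      k≤0 : k ≤ 0
      k≤0 = subst (k ≤_) (sym (⊕-injective x (≤-<-trans z≤n k<m) (m∸[1+i]<m j) (trans (⊕-0 x) (trans (sym (⊕-m x)) e))))
                  (k≤m∸i 1+j≤k)
  ... | ()
  arcB-path x .injective {suc i} {zero} 1+i≤k _ e = sym (arcB-path x .injective z≤n 1+i≤k (sym e))
  arcB-path x .injective {suc i} {suc j} 1+i≤k 1+j≤k e =
    ∸-cancelˡ-≡ (≤-trans 1+i≤k (<⇒≤ k<m)) (≤-trans 1+j≤k (<⇒≤ k<m)) (⊕-injective x (m∸[1+i]<m i) (m∸[1+i]<m j) e)

  m∸1≡k+[k∸1] : m ∸ 1 ≡ k + suc k₀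
  m∸1≡k+[k∸1] = identity k₀
    where identity : ∀ j → suc (j + suc (suc (j + 0))) ≡ suc (suc j) + suc j
          identity = solve-∀

  -- Every label lies within k of k, so this is the distance to vertex k along the cycle.
  dist : Fin m → ℕ
  dist y = ∣ toℕ y - k ∣

  dist-last : ∀ {y} → toℕ y ≡ m ∸ 1 → dist y ≡ suc k₀
  dist-last y≡m∸1 = trans (cong (∣_- k ∣) (trans y≡m∸1 m∸1≡k+[k∸1])) (trans (∣-∣-comm (k + suc k₀) k) (∣m-m+n∣≡n k (suc k₀)))

  dist-Adj : ∀ {a b} → Adj G a b → dist a ≤ suc (dist b)
  dist-Adj {a} {b} (inj₁ b≡1+a) = ≤-trans (∣-∣-triangle (toℕ a) (toℕ b) k) (≤-reflexive (cong (_+ dist b)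
    (trans (cong (∣ toℕ a -_∣) b≡1+a) (trans (∣-∣-comm (toℕ a) (suc (toℕ a))) (∣1+n-n∣≡1 (toℕ a))))))
  dist-Adj {a} {b} (inj₂ (inj₁ a≡1+b)) = ≤-trans (∣-∣-triangle (toℕ a) (toℕ b) k) (≤-reflexive (cong (_+ dist b)
    (trans (cong (∣_- toℕ b ∣) a≡1+b) (∣1+n-n∣≡1 (toℕ b)))))
  dist-Adj {a} {b} (inj₂ (inj₂ (inj₁ (a≡0 , b≡m∸1)))) rewrite a≡0 | dist-last b≡m∸1 = ≤-refl
  dist-Adj {a} {b} (inj₂ (inj₂ (inj₂ (b≡0 , a≡m∸1)))) rewrite b≡0 | dist-last a≡m∸1 = m≤n+m (suc k₀) 2

  weight : Fin m → ℕ
  weight y = 2 ^ (k ∸ dist y)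

  weight-Adj : ∀ {v u} → Adj G v u → weight u ≤ 2 * weight v
  weight-Adj v~u = ^-monoʳ-≤ 2 (k∸b≤1+k∸a k (dist-Adj v~u))

  open Potential G weight weight-Adj

  -- The witness puts all pebbles on vertex 0, at distance k from vertex k.
  not-solvable : ∀ m' → m' < 2 ^ k → ¬ Solvable G m'
  not-solvable m' m'<2^k solvable = <⇒≱ m'<2^k (begin
    2 ^ k               ≡⟨ cong (λ d → 2 ^ (k ∸ d)) (trans (cong (∣_- k ∣) (toℕ-fromℕ< k<m)) (∣n-n∣≡0 k)) ⟨
    weight target       ≤⟨ reachable⇒wt≤potential (solvable p₀ size-p₀ target) ⟩
    potential p₀        ≡⟨ sum-cong-≗ (λ y → *-assoc (ind y fz) m' (weight y)) ⟩
    ∑[ y < m ] (ind y fz * (m' * weight y)) ≡⟨ ∑-ind {m} fz (λ y → m' * weight y) ⟩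
    m' * 2 ^ (k ∸ k)    ≡⟨ cong (λ e → m' * 2 ^ e) (n∸n≡0 k) ⟩
    m' * 1              ≡⟨ *-identityʳ m' ⟩
    m'                  ∎)
    where
      open ≤-Reasoning
      target : Fin m
      target = fromℕ< k<m
      p₀ : Distribution G
      p₀ y = ind y fz * m'
      size-p₀ : size G p₀ ≡ m'
      size-p₀ = trans (size≡∑ G p₀) (∑-ind {m} fz (λ _ → m'))

  m≡k+k : m ≡ k + k
  m≡k+k = cong (k +_) (+-identityʳ k)

  m∸k≡k : m ∸ k ≡ k
  m∸k≡k = trans (cong (_∸ k) m≡k+k) (m+n∸m≡n k k)

  size≡arcs : ∀ p x → size G p ≡ sumUpTo k (p ∘ arcA x) + sumUpTo k (p ∘ arcB x ∘ suc)
  size≡arcs p x = begin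
    size G p                                                   ≡⟨ size≡∑ G p ⟩
    ∑[ y < m ] p y                                             ≡⟨ ∑≡sumUpTo p (p ∘ vertex) (λ y → cong p (sym (vertex-toℕ y))) ⟩
    sumUpTo m (p ∘ vertex)                                     ≡⟨ sumUpTo-rotate m (p ∘ vertex) (λ i → cong p (vertex-+m i)) (toℕ x) ⟨
    sumUpTo m (p ∘ arcA x)                                     ≡⟨ cong (λ n → sumUpTo n (p ∘ arcA x)) m≡k+k ⟩
    sumUpTo (k + k) (p ∘ arcA x)                               ≡⟨ sumUpTo-+ k k (p ∘ arcA x) ⟩
    sumUpTo k (p ∘ arcA x) + sumUpTo k (λ i → p (x ⊕ (k + i))) ≡⟨ cong (sumUpTo k (p ∘ arcA x) +_) far-half ⟩
    sumUpTo k (p ∘ arcA x) + sumUpTo k (p ∘ arcB x ∘ suc)      ∎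
    where
      open ≡-Reasoning
      mirror : ∀ i → i < k → k + (k ∸ suc i) ≡ m ∸ suc i
      mirror i i<k = trans (sym (+-∸-assoc k i<k)) (cong (_∸ suc i) (sym m≡k+k))
      far-half : sumUpTo k (λ i → p (x ⊕ (k + i))) ≡ sumUpTo k (p ∘ arcB x ∘ suc)
      far-half = trans (sumUpTo-reverse k (λ i → p (x ⊕ (k + i)))) (sumUpTo-cong k (λ i i<k → cong (λ o → p (x ⊕ o)) (mirror i i<k)))

  -- Each vertex other than the antipode x ⊕ k is counted with weight at least 2 along one of the arcs.
  arcs-weight : ∀ p x → 2 * size G p ≤ pathWeight (p ∘ arcA x) k + pathWeight (p ∘ arcB x) k
  arcs-weight p x = +-cancelʳ-≤ c _ _ (begin
    2 * size G p + c                ≡⟨ cong (λ s → 2 * s + c) (size≡arcs p x) ⟩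
    2 * (sA + sB) + c               ≡⟨ regroup sA sB c ⟩
    (2 * sA + c) + 2 * sB           ≤⟨ +-mono-≤ (2*sum+last≤pathWeight k (p ∘ arcA x)) (2*sum∘suc≤pathWeight+last k (p ∘ arcB x)) ⟩
    wA + (wB + p (x ⊕ (m ∸ k)))     ≡⟨ cong (λ o → wA + (wB + p (x ⊕ o))) m∸k≡k ⟩
    wA + (wB + c)                   ≡⟨ +-assoc wA wB c ⟨
    wA + wB + c                     ∎)
    where
      open ≤-Reasoning
      c = p (x ⊕ k)
      sA = sumUpTo k (p ∘ arcA x)
      sB = sumUpTo k (p ∘ arcB x ∘ suc)
      wA = pathWeight (p ∘ arcA x) k
      wB = pathWeight (p ∘ arcB x) k
      regroup : ∀ a b c → 2 * (a + b) + c ≡ (2 * a + c) + 2 * b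
      regroup = solve-∀

  solvable : Solvable G (2 ^ k)
  solvable p size≡2^k x with 2 ^ k ≤? pathWeight (p ∘ arcA x) k
  ... | yes heavyA = reach-along k (arcA-path x) (⊕-0 x) heavyA
  ... | no lightA = reach-along k (arcB-path x) (⊕-m x) (2*n≤a+b⇒n≤b both-arcs (<⇒≤ (≰⇒> lightA)))
    where
      both-arcs : 2 * 2 ^ k ≤ pathWeight (p ∘ arcA x) k + pathWeight (p ∘ arcB x) k
      both-arcs = subst (λ s → 2 * s ≤ pathWeight (p ∘ arcA x) k + pathWeight (p ∘ arcB x) k) size≡2^k (arcs-weight p x)

mainTheorem11 : (k : ℕ) → 2 ≤ k → IsRubblingNumber (Cycle (2 * k)) (2 ^ k)
mainTheorem11 (suc (suc k₀)) _ = EvenCycle.solvable k₀ , EvenCycle.not-solvable k₀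
mainTheorem11 (suc zero) (s≤s ())
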